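{- Let $x$ be an integer with $x\equiv\pm 2\pmod 5$ and $x\notin\{\pm2,\pm3\}$. Then $x^2+1$ can be written as $u^2+v^2$ with integers $u,v$ satisfying $u^2\neq 1$ and $v^2\neq 1$. -}

module Defs where

{-# OPTIONS --safe #-}
-- Write x = 5q + 2 (replacing x by -x if x ≡ -2 mod 5). Then
--   x² + 1 = (4q + 1)² + (3q + 2)²,
-- and a summand is 1 only if 4q + 1 = ±1 or 3q + 2 = ±1, i.e. q = 0 or q = -1,
-- which are exactly the excluded cases x = 2 and x = -3.
module Submission where

open import Defs
open import Data.Integer using (ℤ; +_; -_; _+_; _-_; _*_; +[1+_]; -[1+_])
open import Data.Integer.Divisibility using (_∣_)
open import Data.Integer.Divisibility.Signed using (divides; ∣ᵤ⇒∣)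
open import Data.Integer.Tactic.RingSolver using (solve-∀)
open import Data.Nat using (suc)
open import Data.Product using (∃; ∃₂; _×_; _,_)
open import Data.Sum using (_⊎_; inj₁; inj₂)
open import Relation.Binary.PropositionalEquality
  using (_≡_; _≢_; refl; sym; cong; subst; module ≡-Reasoning)

NontrivialSumOfTwoSquares : ℤ → Set
NontrivialSumOfTwoSquares n =
  ∃₂ λ (u v : ℤ) → (n ≡ u * u + v * v) × (u * u ≢ + 1) × (v * v ≢ + 1)

i*i≡1⇒i≡±1 : ∀ i → i * i ≡ + 1 → i ≡ + 1 ⊎ i ≡ - + 1
i*i≡1⇒i≡±1 (+ 1)           _ = inj₁ refl
i*i≡1⇒i≡±1 (+[1+ suc _ ]) ()
i*i≡1⇒i≡±1 (+ 0)          ()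
i*i≡1⇒i≡±1 (-[1+ 0 ])      _ = inj₂ refl
i*i≡1⇒i≡±1 (-[1+ suc _ ]) ()

q*4+1≡±1⇒q≡0 : ∀ q → q * + 4 + + 1 ≡ + 1 ⊎ q * + 4 + + 1 ≡ - + 1 → q ≡ + 0
q*4+1≡±1⇒q≡0 (+ 0)      _        = refl
q*4+1≡±1⇒q≡0 +[1+ _ ]  (inj₁ ())
q*4+1≡±1⇒q≡0 +[1+ _ ]  (inj₂ ())
q*4+1≡±1⇒q≡0 -[1+ _ ]  (inj₁ ())
q*4+1≡±1⇒q≡0 -[1+ _ ]  (inj₂ ())

q*3+2≡±1⇒q≡-1 : ∀ q → q * + 3 + + 2 ≡ + 1 ⊎ q * + 3 + + 2 ≡ - + 1 → q ≡ - + 1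
q*3+2≡±1⇒q≡-1 -[1+ 0 ]       _        = refl
q*3+2≡±1⇒q≡-1 -[1+ suc _ ]  (inj₁ ())
q*3+2≡±1⇒q≡-1 -[1+ suc _ ]  (inj₂ ())
q*3+2≡±1⇒q≡-1 (+ 0)          (inj₁ ())
q*3+2≡±1⇒q≡-1 (+ 0)          (inj₂ ())
q*3+2≡±1⇒q≡-1 +[1+ _ ]      (inj₁ ())
q*3+2≡±1⇒q≡-1 +[1+ _ ]      (inj₂ ())

[5q+2]²+1≡[4q+1]²+[3q+2]² : ∀ q →
  (q * + 5 + + 2) * (q * + 5 + + 2) + + 1
    ≡ (q * + 4 + + 1) * (q * + 4 + + 1) + (q * + 3 + + 2) * (q * + 3 + + 2)
[5q+2]²+1≡[4q+1]²+[3q+2]² = solve-∀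

[5q+2]²+1-nontrivial : ∀ q → q ≢ + 0 → q ≢ - + 1 →
  NontrivialSumOfTwoSquares ((q * + 5 + + 2) * (q * + 5 + + 2) + + 1)
[5q+2]²+1-nontrivial q q≢0 q≢-1 =
  q * + 4 + + 1 , q * + 3 + + 2 , [5q+2]²+1≡[4q+1]²+[3q+2]² q ,
  (λ sq≡1 → q≢0  (q*4+1≡±1⇒q≡0  q (i*i≡1⇒i≡±1 _ sq≡1))) ,
  (λ sq≡1 → q≢-1 (q*3+2≡±1⇒q≡-1 q (i*i≡1⇒i≡±1 _ sq≡1)))

∣x-r⇒x≡q*k+r : ∀ {k x} r → k ∣ x - r → ∃ λ q → x ≡ q * k + r
∣x-r⇒x≡q*k+r {k} {x} r k∣x-r with ∣ᵤ⇒∣ {k} {x - r} k∣x-r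
... | divides q x-r≡q*k = q , (begin
  x             ≡⟨ x≡[x-r]+r x r ⟩
  (x - r) + r   ≡⟨ cong (_+ r) x-r≡q*k ⟩
  q * k + r     ∎)
  where
  open ≡-Reasoning
  x≡[x-r]+r : ∀ x r → x ≡ (x - r) + r
  x≡[x-r]+r = solve-∀

∣x+r⇒x≡-[q*k+r] : ∀ {k x} r → k ∣ x + r → ∃ λ q → x ≡ - (q * k + r)
∣x+r⇒x≡-[q*k+r] {k} {x} r k∣x+r with ∣ᵤ⇒∣ {k} {x + r} k∣x+r
... | divides q x+r≡q*k = - q , (begin
  x                  ≡⟨ x≡[x+r]-r x r ⟩
  (x + r) - r        ≡⟨ cong (_- r) x+r≡q*k ⟩
  q * k - r          ≡⟨ q*k-r≡-[-q*k+r] q k r ⟩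
  - (- q * k + r)    ∎)
  where
  open ≡-Reasoning
  x≡[x+r]-r : ∀ x r → x ≡ (x + r) - r
  x≡[x+r]-r = solve-∀
  q*k-r≡-[-q*k+r] : ∀ q k r → q * k - r ≡ - (- q * k + r)
  q*k-r≡-[-q*k+r] = solve-∀

-i*-i≡i*i : ∀ i → - i * - i ≡ i * i
-i*-i≡i*i = solve-∀

lemma2p5 : (x : ℤ) → (+ 5 ∣ x - + 2) ⊎ (+ 5 ∣ x + + 2) →
             x ≢ + 2 → x ≢ - + 2 → x ≢ + 3 → x ≢ - + 3 →
             ∃₂ λ (u v : ℤ) → (x * x + + 1 ≡ u * u + v * v) × (u * u ≢ + 1) × (v * v ≢ + 1)
-- Instantiating q := 0 or q := -1 makes x ≡ q * 5 ± 2 compute to one of the excluded values.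
lemma2p5 x (inj₁ 5∣x-2) x≢2 _ _ x≢-3 with ∣x-r⇒x≡q*k+r (+ 2) 5∣x-2
... | q , x≡5q+2 =
  subst (λ y → NontrivialSumOfTwoSquares (y * y + + 1)) (sym x≡5q+2)
    ([5q+2]²+1-nontrivial q (λ { refl → x≢2 x≡5q+2 }) (λ { refl → x≢-3 x≡5q+2 }))
lemma2p5 x (inj₂ 5∣x+2) _ x≢-2 x≢3 _ with ∣x+r⇒x≡-[q*k+r] (+ 2) 5∣x+2
... | q , x≡-[5q+2] =
  subst (λ y → NontrivialSumOfTwoSquares (y * y + + 1)) (sym x≡-[5q+2])
    (subst (λ s → NontrivialSumOfTwoSquares (s + + 1)) (sym (-i*-i≡i*i (q * + 5 + + 2)))
      ([5q+2]²+1-nontrivial q (λ { refl → x≢-2 x≡-[5q+2] }) (λ { refl → x≢3 x≡-[5q+2] })))
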